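{- Let $n\ge 4$ and $t\in[n-1]$ be integers, and let $S$ be a weak $(2n-2t)$-resolving set of $K_n\times K_n$, with $\overline{S}=V\setminus S$. For all distinct $i,i'\in[n]$: if there exists $j\in[n]$ with $(i,j)\in\overline{S}$ and $(i',j)\in\overline{S}$, then $|(L_i\cup L_{i'})\cap\overline{S}|\le 2t$; otherwise $|(L_i\cup L_{i'})\cap\overline{S}|\le 2t+1$.
   Context: $K_n\times K_n$ is the direct product of two complete graphs: vertex set $V=[n]\times[n]$ with $[n]=\{1,\dots,n\}$, where $(i,j)$ and $(i',j')$ are adjacent iff $i\ne i'$ and $j\ne j'$. For $i\in[n]$, $L_i=\{(i,j):j\in[n]\}$. With $d$ the shortest-path distance, for $S\subseteq V$ and vertices $x,y,z$: $\Delta_z(x,y)=|d(x,z)-d(y,z)|$ and $\Delta_S(x,y)=\sum_{z\in S}\Delta_z(x,y)$. A set $S$ of vertices is a weak $k$-resolving set if $\Delta_S(x,y)\ge k$ for all distinct vertices $x,y$. -}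

module Defs where

open import Data.Nat using (ℕ; zero; suc; _+_; _*_; ∣_-_∣)
open import Data.Bool using (Bool; true; false; _∧_; _∨_; not; if_then_else_)
open import Data.Fin using (Fin)
open import Data.Fin.Properties using () renaming (_≟_ to _≟F_)
open import Data.Product using (_×_; _,_; proj₁; proj₂)
open import Data.List using (List; []; _∷_; map; concatMap; allFin; filter; length)
open import Data.Bool.ListAction using (any)
open import Data.Nat.ListAction using (sum)
open import Data.Nat using (_≤_)
open import Data.Bool.Properties using () renaming (_≟_ to _≟B_)
open import Relation.Binary.PropositionalEquality using (_≢_)
open import Relation.Nullary.Decidable using (⌊_⌋)
open import Relation.Binary.PropositionalEquality using (_≡_)

V : ℕ → Set
V n = Fin n × Fin n

_==_ : ∀ {n} → Fin n → Fin n → Bool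
a == b = ⌊ a ≟F b ⌋

eqV : ∀ {n} → V n → V n → Bool
eqV (i , j) (i' , j') = (i == i') ∧ (j == j')

adj : ∀ {n} → V n → V n → Bool
adj (i , j) (i' , j') = not (i == i') ∧ not (j == j')

vertices : (n : ℕ) → List (V n)
vertices n = concatMap (λ i → map (i ,_) (allFin n)) (allFin n)

reach : ∀ {n} → ℕ → V n → V n → Bool
reach zero    x y = eqV x y
reach {n} (suc k) x y = reach k x y ∨ any (λ z → adj x z ∧ reach k z y) (vertices n)

search : ∀ {n} → ℕ → ℕ → V n → V n → ℕ
search zero      k x y = k
search (suc fuel) k x y = if reach k x y then k else search fuel (suc k) x y

-- shortest-path distance d(x,y) (any walk-distance is < n*n; for disconnected
-- pairs the value n*n is returned, which never happens for n ≥ 3)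
dist : ∀ {n} → V n → V n → ℕ
dist {n} x y = search (n * n) 0 x y

VSet : ℕ → Set
VSet n = V n → Bool

Δ : ∀ {n} → V n → V n → V n → ℕ
Δ z x y = ∣ dist x z - dist y z ∣

ΔS : ∀ {n} → VSet n → V n → V n → ℕ
ΔS {n} S x y = sum (map (λ z → Δ z x y) (filter (λ z → S z ≟B true) (vertices n)))

WeakResolving : ∀ {n} → ℕ → VSet n → Set
WeakResolving {n} k S = ∀ (x y : V n) → x ≢ y → k ≤ ΔS S x y

compl : ∀ {n} → VSet n → VSet n
compl S z = not (S z)

cardLinesIn : ∀ {n} → VSet n → Fin n → Fin n → ℕ
cardLinesIn {n} T i i' =
  length (filter (λ z → ((proj₁ z == i) ∨ (proj₁ z == i')) ∧ T z ≟B true) (vertices n))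

-- In K_n × K_n with n ≥ 3 the distance between two vertices is 0, 1 or 2 according as they are
-- equal, adjacent, or share exactly one coordinate. Hence for x = (i , j) and y = (i' , j) the
-- only vertices z with Δ_z(x,y) ≠ 0 lie on L_i ∪ L_i', where Δ_z(x,y) = 1 + [z = x] + [z = y].
-- Summing over S gives Δ_S(x,y) = 2n − |(L_i ∪ L_i') ∩ S̄| + [x ∈ S] + [y ∈ S], so weak
-- (2n − 2t)-resolvability bounds |(L_i ∪ L_i') ∩ S̄| by 2t + [x ∈ S] + [y ∈ S] for every column j.
-- A column with x, y ∉ S gives 2t; a column meeting S̄ at all gives 2t + 1, and if there is no
-- such column the count is 0.
module Submission where

open import Defs
open import Data.Nat using (ℕ; zero; suc; _+_; _*_; _∸_; _≤_; z≤n; s≤s; ∣_-_∣)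
open import Data.Nat.Properties
  using ( ≤-refl; ≤-reflexive; ≤-trans; +-assoc; +-identityʳ; *-identityˡ; *-identityʳ
        ; +-monoˡ-≤; +-monoʳ-≤; *-monoʳ-≤; +-cancelˡ-≤; m∸n≤m; m∸n+n≡m
        ; +-commutativeSemigroup; module ≤-Reasoning )
open import Data.Bool using (Bool; true; false; _∧_; _∨_; not)
open import Data.Bool.Properties using (∧-zeroʳ; ∧-identityʳ; ∨-zeroʳ; ¬-not) renaming (_≟_ to _≟B_)
open import Data.Fin using (Fin; zero; suc)
open import Data.Fin.Properties using (any?; suc-injective) renaming (_≟_ to _≟F_)
open import Data.Product using (_×_; _,_; proj₁; proj₂; ∃-syntax)
open import Data.Product.Properties using (≡-dec; ,-injectiveˡ; ,-injectiveʳ)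
open import Data.Sum using (_⊎_; inj₁; inj₂)
open import Data.List using (List; []; _∷_; _++_; map; concatMap; allFin; filter; length)
open import Data.List.Properties using (map-tabulate; map-∘; map-cong; map-++)
open import Data.Bool.ListAction using (any)
open import Data.Nat.ListAction using (sum)
open import Data.Nat.ListAction.Properties using (sum-++)
open import Data.List.Membership.Propositional using (_∈_)
open import Data.List.Membership.Propositional.Properties using (∈-concatMap⁺; ∈-map⁺; ∈-allFin)
open import Data.List.Relation.Unary.Any using (here; there)
import Data.List.Relation.Unary.Any as Any
open import Algebra.Properties.CommutativeSemigroup +-commutativeSemigroup using (interchange)
open import Function using (id; _∘_)
open import Relation.Nullary using (¬_; yes; no; contradiction)
open import Relation.Nullary.Decidable using (dec-true; dec-false; isYes≗does; _⊎-dec_)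
open import Relation.Binary.Definitions using (DecidableEquality)
open import Relation.Binary.PropositionalEquality

χ : Bool → ℕ
χ true  = 1
χ false = 0

χ-∨ : ∀ p q → p ∧ q ≡ false → χ (p ∨ q) ≡ χ p + χ q
χ-∨ true  false _ = refl
χ-∨ false q     _ = refl

χ≡0 : ∀ {b} → not b ≡ true → χ b ≡ 0
χ≡0 {false} _ = refl

χ+χ≤1 : ∀ {a b} → not a ≡ true ⊎ not b ≡ true → χ a + χ b ≤ 1
χ+χ≤1 {false} {false} _ = z≤n
χ+χ≤1 {false} {true}  _ = ≤-refl
χ+χ≤1 {true}  {false} _ = ≤-refl
χ+χ≤1 {true}  {true}  (inj₁ ())
χ+χ≤1 {true}  {true}  (inj₂ ())

χ-split : ∀ s l e e' → χ s * (χ l + (χ e + χ e')) + χ (l ∧ not s) ≡ χ l + (χ (s ∧ e) + χ (s ∧ e'))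
χ-split true  l e e' = trans (cong₂ _+_ (*-identityˡ _) (cong χ (∧-zeroʳ l))) (+-identityʳ _)
χ-split false l e e' = trans (cong χ (∧-identityʳ l)) (sym (+-identityʳ (χ l)))

any-≡-true : ∀ {A : Set} (p : A → Bool) {x : A} {xs : List A} → x ∈ xs → p x ≡ true → any p xs ≡ true
any-≡-true p (here refl) px rewrite px = refl
any-≡-true p {xs = y ∷ _} (there x∈xs) px rewrite any-≡-true p x∈xs px = ∨-zeroʳ (p y)

any-≡-false : ∀ {A : Set} (p : A → Bool) (xs : List A) → (∀ x → p x ≡ false) → any p xs ≡ false
any-≡-false p []       _    = refl
any-≡-false p (x ∷ xs) px≡f rewrite px≡f x = any-≡-false p xs px≡f

module _ {A : Set} where

  sum-map-+ : (f g : A → ℕ) (xs : List A) →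
              sum (map (λ x → f x + g x) xs) ≡ sum (map f xs) + sum (map g xs)
  sum-map-+ f g []       = refl
  sum-map-+ f g (x ∷ xs) =
    trans (cong (f x + g x +_) (sum-map-+ f g xs)) (interchange (f x) (g x) _ _)

  sum-map-cong : {f g : A → ℕ} → (∀ x → f x ≡ g x) → (xs : List A) → sum (map f xs) ≡ sum (map g xs)
  sum-map-cong f≗g xs = cong sum (map-cong f≗g xs)

  sum-map-zero : {f : A → ℕ} → (∀ x → f x ≡ 0) → (xs : List A) → sum (map f xs) ≡ 0
  sum-map-zero f≡0 []       = refl
  sum-map-zero f≡0 (x ∷ xs) rewrite f≡0 x = sum-map-zero f≡0 xs

  sum-map-filter : (P : A → Bool) (g : A → ℕ) (xs : List A) →
                   sum (map g (filter (λ x → P x ≟B true) xs)) ≡ sum (map (λ x → χ (P x) * g x) xs)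
  sum-map-filter P g []       = refl
  sum-map-filter P g (x ∷ xs) with P x
  ... | true  = cong₂ _+_ (sym (*-identityˡ (g x))) (sum-map-filter P g xs)
  ... | false = sum-map-filter P g xs

  length-filter≡sum-χ : (P : A → Bool) (xs : List A) →
                        length (filter (λ x → P x ≟B true) xs) ≡ sum (map (χ ∘ P) xs)
  length-filter≡sum-χ P []       = refl
  length-filter≡sum-χ P (x ∷ xs) with P x
  ... | true  = cong suc (length-filter≡sum-χ P xs)
  ... | false = length-filter≡sum-χ P xs

  sum-map-concatMap : {C : Set} (g : C → ℕ) (f : A → List C) (xs : List A) →
                      sum (map g (concatMap f xs)) ≡ sum (map (λ x → sum (map g (f x))) xs)
  sum-map-concatMap g f []       = refl
  sum-map-concatMap g f (x ∷ xs) = begin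
    sum (map g (f x ++ concatMap f xs))              ≡⟨ cong sum (map-++ g (f x) _) ⟩
    sum (map g (f x) ++ map g (concatMap f xs))      ≡⟨ sum-++ (map g (f x)) _ ⟩
    sum (map g (f x)) + sum (map g (concatMap f xs)) ≡⟨ cong (sum (map g (f x)) +_) (sum-map-concatMap g f xs) ⟩
    sum (map g (f x)) + sum (map (λ y → sum (map g (f y))) xs) ∎
    where open ≡-Reasoning

sum-allFin-suc : ∀ {n} (F : Fin (suc n) → ℕ) →
                 sum (map F (allFin (suc n))) ≡ F zero + sum (map (F ∘ suc) (allFin n))
sum-allFin-suc F =
  cong (λ xs → F zero + sum xs) (trans (map-tabulate suc F) (sym (map-tabulate id (F ∘ suc))))

sum-allFin-const : ∀ n k → sum (map (λ _ → k) (allFin n)) ≡ n * k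
sum-allFin-const zero    k = refl
sum-allFin-const (suc n) k = trans (sum-allFin-suc {n} (λ _ → k)) (cong (k +_) (sum-allFin-const n k))

sum-allFin-δ : ∀ {n} (F : Fin n → ℕ) (d : Fin n) → (∀ b → b ≢ d → F b ≡ 0) →
               sum (map F (allFin n)) ≡ F d
sum-allFin-δ {suc n} F zero vanish = begin
  sum (map F (allFin (suc n)))            ≡⟨ sum-allFin-suc F ⟩
  F zero + sum (map (F ∘ suc) (allFin n)) ≡⟨ cong (F zero +_) (sum-map-zero (λ b → vanish (suc b) (λ ())) (allFin n)) ⟩
  F zero + 0                              ≡⟨ +-identityʳ (F zero) ⟩
  F zero                                  ∎
  where open ≡-Reasoning
sum-allFin-δ {suc n} F (suc d) vanish = begin
  sum (map F (allFin (suc n)))            ≡⟨ sum-allFin-suc F ⟩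
  F zero + sum (map (F ∘ suc) (allFin n)) ≡⟨ cong (_+ sum (map (F ∘ suc) (allFin n))) (vanish zero (λ ())) ⟩
  sum (map (F ∘ suc) (allFin n))          ≡⟨ sum-allFin-δ (F ∘ suc) d (λ b b≢d → vanish (suc b) (b≢d ∘ suc-injective)) ⟩
  F (suc d)                               ∎
  where open ≡-Reasoning

module _ {n : ℕ} where

  ==-refl : (a : Fin n) → a == a ≡ true
  ==-refl a = trans (isYes≗does (a ≟F a)) (dec-true (a ≟F a) refl)

  ==-≢ : {a b : Fin n} → a ≢ b → a == b ≡ false
  ==-≢ {a} {b} a≢b = trans (isYes≗does (a ≟F b)) (dec-false (a ≟F b) a≢b)

  ==-sym : (a b : Fin n) → a == b ≡ b == a
  ==-sym a b with a ≟F b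
  ... | yes refl = sym (==-refl a)
  ... | no a≢b   = sym (==-≢ (≢-sym a≢b))

  ==-disjoint : {i i' : Fin n} → i ≢ i' → (a : Fin n) → (a == i) ∧ (a == i') ≡ false
  ==-disjoint {i} i≢i' a with a ≟F i
  ... | yes refl = ==-≢ i≢i'
  ... | no _     = refl

  _≟V_ : DecidableEquality (V n)
  _≟V_ = ≡-dec _≟F_ _≟F_

  eqV-refl : (x : V n) → eqV x x ≡ true
  eqV-refl (a , b) rewrite ==-refl a | ==-refl b = refl

  eqV-≢ : {x y : V n} → x ≢ y → eqV x y ≡ false
  eqV-≢ {a , b} {c , d} x≢y with a ≟F c | b ≟F d
  ... | yes refl | yes refl = contradiction refl x≢y
  ... | yes refl | no _     = refl
  ... | no _     | _        = refl

  adj-≢ : {a b c d : Fin n} → a ≢ c → b ≢ d → adj (a , b) (c , d) ≡ true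
  adj-≢ a≢c b≢d rewrite ==-≢ a≢c | ==-≢ b≢d = refl

  ∈-vertices : (x : V n) → x ∈ vertices n
  ∈-vertices (a , b) =
    ∈-concatMap⁺ (λ i → map (i ,_) (allFin n))
      (Any.map (λ { refl → ∈-map⁺ (a ,_) (∈-allFin b) }) (∈-allFin a))

  any-∧-eqV : (g : V n → Bool) (y : V n) → any (λ z → g z ∧ eqV z y) (vertices n) ≡ g y
  any-∧-eqV g y with g y in gy
  ... | true  = any-≡-true _ (∈-vertices y) (trans (cong (_∧ eqV y y) gy) (eqV-refl y))
  ... | false = any-≡-false _ (vertices n) vanish
    where
    vanish : ∀ z → g z ∧ eqV z y ≡ false
    vanish z with z ≟V y
    ... | yes refl = cong (_∧ eqV y y) gy
    ... | no z≢y   = trans (cong (g z ∧_) (eqV-≢ z≢y)) (∧-zeroʳ (g z))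

  reach-1 : (x y : V n) → reach 1 x y ≡ eqV x y ∨ adj x y
  reach-1 x y = cong (eqV x y ∨_) (any-∧-eqV (adj x) y)

  sum-vertices : (g : V n → ℕ) →
                 sum (map g (vertices n)) ≡ sum (map (λ a → sum (map (λ b → g (a , b)) (allFin n))) (allFin n))
  sum-vertices g = trans (sum-map-concatMap g (λ a → map (a ,_) (allFin n)) (allFin n))
                         (sum-map-cong (λ a → cong sum (sym (map-∘ (allFin n)))) (allFin n))

  sum-vertices-δ : (g : V n → ℕ) (x : V n) → (∀ z → z ≢ x → g z ≡ 0) → sum (map g (vertices n)) ≡ g x
  sum-vertices-δ g (c , d) vanish = begin
    sum (map g (vertices n))                                            ≡⟨ sum-vertices g ⟩
    sum (map (λ a → sum (map (λ b → g (a , b)) (allFin n))) (allFin n)) ≡⟨ sum-allFin-δ _ c off-row ⟩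
    sum (map (λ b → g (c , b)) (allFin n))                              ≡⟨ sum-allFin-δ _ d off-column ⟩
    g (c , d)                                                           ∎
    where
    open ≡-Reasoning
    off-row : ∀ a → a ≢ c → sum (map (λ b → g (a , b)) (allFin n)) ≡ 0
    off-row a a≢c = sum-map-zero (λ b → vanish (a , b) (a≢c ∘ ,-injectiveˡ)) (allFin n)
    off-column : ∀ b → b ≢ d → g (c , b) ≡ 0
    off-column b b≢d = vanish (c , b) (b≢d ∘ ,-injectiveʳ)

  sum-χ-∧-eqV : (P : V n → Bool) (x : V n) → sum (map (λ z → χ (P z ∧ eqV z x)) (vertices n)) ≡ χ (P x)
  sum-χ-∧-eqV P x = begin
    sum (map (λ z → χ (P z ∧ eqV z x)) (vertices n)) ≡⟨ sum-vertices-δ _ x vanish ⟩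
    χ (P x ∧ eqV x x)                                ≡⟨ cong (λ b → χ (P x ∧ b)) (eqV-refl x) ⟩
    χ (P x ∧ true)                                   ≡⟨ cong χ (∧-identityʳ (P x)) ⟩
    χ (P x)                                          ∎
    where
    open ≡-Reasoning
    vanish : ∀ z → z ≢ x → χ (P z ∧ eqV z x) ≡ 0
    vanish z z≢x = cong χ (trans (cong (P z ∧_) (eqV-≢ z≢x)) (∧-zeroʳ (P z)))

  sum-χ-line : (i : Fin n) → sum (map (λ z → χ (proj₁ z == i)) (vertices n)) ≡ n
  sum-χ-line i = begin
    sum (map (λ z → χ (proj₁ z == i)) (vertices n))                      ≡⟨ sum-vertices _ ⟩
    sum (map (λ a → sum (map (λ _ → χ (a == i)) (allFin n))) (allFin n)) ≡⟨ sum-allFin-δ _ i off-line ⟩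
    sum (map (λ _ → χ (i == i)) (allFin n))                              ≡⟨ sum-allFin-const n _ ⟩
    n * χ (i == i)                                                       ≡⟨ cong (λ b → n * χ b) (==-refl i) ⟩
    n * 1                                                                ≡⟨ *-identityʳ n ⟩
    n                                                                    ∎
    where
    open ≡-Reasoning
    off-line : ∀ a → a ≢ i → sum (map (λ _ → χ (a == i)) (allFin n)) ≡ 0
    off-line a a≢i = sum-map-zero (λ _ → cong χ (==-≢ a≢i)) (allFin n)

avoid : ∀ {k} (u v : Fin (3 + k)) → ∃[ w ] (u ≢ w × v ≢ w)
avoid zero          zero          = suc zero , (λ ()) , (λ ())
avoid zero          (suc zero)    = suc (suc zero) , (λ ()) , (λ ())
avoid zero          (suc (suc _)) = suc zero , (λ ()) , (λ ())
avoid (suc zero)    zero          = suc (suc zero) , (λ ()) , (λ ())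
avoid (suc (suc _)) zero          = suc zero , (λ ()) , (λ ())
avoid (suc _)       (suc _)       = zero , (λ ()) , (λ ())

reach-2 : ∀ {k} (x y : V (3 + k)) → reach 2 x y ≡ true
reach-2 x@(a , b) y@(c , d) with avoid a c | avoid b d
... | e , a≢e , c≢e | f , b≢f , d≢f =
  trans (cong (reach 1 x y ∨_) (any-≡-true (λ z → adj x z ∧ reach 1 z y) (∈-vertices (e , f)) via-ef))
        (∨-zeroʳ (reach 1 x y))
  where
  via-ef : adj x (e , f) ∧ reach 1 (e , f) y ≡ true
  via-ef rewrite adj-≢ a≢e b≢f | reach-1 (e , f) y | adj-≢ (≢-sym c≢e) (≢-sym d≢f) =
    ∨-zeroʳ (eqV (e , f) y)

distᵇ : Bool → Bool → ℕ
distᵇ true  true  = 0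
distᵇ false false = 1
distᵇ _     _     = 2

-- reach-2 must be rewritten first: reach 2 x y unfolds to a term containing reach 1 x y.
dist≡distᵇ : ∀ {k} (x y : V (3 + k)) → dist x y ≡ distᵇ (proj₁ x == proj₁ y) (proj₂ x == proj₂ y)
dist≡distᵇ x@(a , b) y@(c , d) rewrite reach-2 x y | reach-1 x y with a == c | b == d
... | true  | true  = refl
... | true  | false = refl
... | false | true  = refl
... | false | false = refl

distᵇ-difference : ∀ p q r → p ∧ q ≡ false →
                   ∣ distᵇ p r - distᵇ q r ∣ ≡ χ (p ∨ q) + (χ (p ∧ r) + χ (q ∧ r))
distᵇ-difference true  false true  _ = refl
distᵇ-difference true  false false _ = refl
distᵇ-difference false true  true  _ = refl
distᵇ-difference false true  false _ = refl
distᵇ-difference false false true  _ = refl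
distᵇ-difference false false false _ = refl

onLines : ∀ {n} → Fin n → Fin n → V n → Bool
onLines i i' z = (proj₁ z == i) ∨ (proj₁ z == i')

Δ-same-column : ∀ {k} {i i' : Fin (3 + k)} → i ≢ i' → ∀ j z →
                Δ z (i , j) (i' , j) ≡ χ (onLines i i' z) + (χ (eqV z (i , j)) + χ (eqV z (i' , j)))
Δ-same-column {i = i} {i'} i≢i' j z@(a , b)
  rewrite dist≡distᵇ (i , j) z | dist≡distᵇ (i' , j) z | ==-sym i a | ==-sym i' a | ==-sym j b =
  distᵇ-difference (a == i) (a == i') (b == j) (==-disjoint i≢i' a)

sum-χ-onLines : ∀ {n} {i i' : Fin n} → i ≢ i' → sum (map (χ ∘ onLines i i') (vertices n)) ≡ 2 * n
sum-χ-onLines {n} {i} {i'} i≢i' = begin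
  sum (map (χ ∘ onLines i i') (vertices n))
    ≡⟨ sum-map-cong (λ (a , _) → χ-∨ (a == i) (a == i') (==-disjoint i≢i' a)) (vertices n) ⟩
  sum (map (λ z → χ (proj₁ z == i) + χ (proj₁ z == i')) (vertices n))
    ≡⟨ sum-map-+ (λ z → χ (proj₁ z == i)) (λ z → χ (proj₁ z == i')) (vertices n) ⟩
  sum (map (λ z → χ (proj₁ z == i)) (vertices n)) + sum (map (λ z → χ (proj₁ z == i')) (vertices n))
    ≡⟨ cong₂ _+_ (sum-χ-line i) (sum-χ-line i') ⟩
  n + n
    ≡⟨ cong (n +_) (sym (+-identityʳ n)) ⟩
  2 * n ∎
  where open ≡-Reasoning

ΔS+cardLinesIn-compl : ∀ {k} (S : VSet (3 + k)) {i i' : Fin (3 + k)} → i ≢ i' → ∀ j →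
  ΔS S (i , j) (i' , j) + cardLinesIn (compl S) i i' ≡ 2 * (3 + k) + (χ (S (i , j)) + χ (S (i' , j)))
ΔS+cardLinesIn-compl {k} S {i} {i'} i≢i' j = begin
  ΔS S x y + cardLinesIn (compl S) i i'
    ≡⟨ cong₂ _+_ (sum-map-filter S (λ z → Δ z x y) Vs)
                 (length-filter≡sum-χ (λ z → L z ∧ not (S z)) Vs) ⟩
  sum (map (λ z → χ (S z) * Δ z x y) Vs) + sum (map (λ z → χ (L z ∧ not (S z))) Vs)
    ≡⟨ sym (sum-map-+ (λ z → χ (S z) * Δ z x y) (λ z → χ (L z ∧ not (S z))) Vs) ⟩
  sum (map (λ z → χ (S z) * Δ z x y + χ (L z ∧ not (S z))) Vs)
    ≡⟨ sum-map-cong split Vs ⟩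
  sum (map (λ z → χ (L z) + (atx z + aty z)) Vs)
    ≡⟨ trans (sum-map-+ (χ ∘ L) (λ z → atx z + aty z) Vs)
             (cong (sum (map (χ ∘ L) Vs) +_) (sum-map-+ atx aty Vs)) ⟩
  sum (map (χ ∘ L) Vs) + (sum (map atx Vs) + sum (map aty Vs))
    ≡⟨ cong₂ _+_ (sum-χ-onLines i≢i') (cong₂ _+_ (sum-χ-∧-eqV S x) (sum-χ-∧-eqV S y)) ⟩
  2 * (3 + k) + (χ (S x) + χ (S y)) ∎
  where
  open ≡-Reasoning
  x y : V (3 + k)
  x = i , j
  y = i' , j
  Vs : List (V (3 + k))
  Vs = vertices (3 + k)
  L : V (3 + k) → Bool
  L = onLines i i'
  atx aty : V (3 + k) → ℕ
  atx z = χ (S z ∧ eqV z x)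
  aty z = χ (S z ∧ eqV z y)
  split : ∀ z → χ (S z) * Δ z x y + χ (L z ∧ not (S z)) ≡ χ (L z) + (atx z + aty z)
  split z = trans (cong (λ d → χ (S z) * d + χ (L z ∧ not (S z))) (Δ-same-column i≢i' j z))
                  (χ-split (S z) (L z) (eqV z x) (eqV z y))

weakResolving⇒cardLinesIn-compl : ∀ {k r} {S : VSet (3 + k)} → WeakResolving r S →
  {i i' : Fin (3 + k)} → i ≢ i' → ∀ j →
  r + cardLinesIn (compl S) i i' ≤ 2 * (3 + k) + (χ (S (i , j)) + χ (S (i' , j)))
weakResolving⇒cardLinesIn-compl {S = S} resolving {i} {i'} i≢i' j =
  ≤-trans (+-monoˡ-≤ (cardLinesIn (compl S) i i') (resolving (i , j) (i' , j) (i≢i' ∘ ,-injectiveˡ)))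
          (≤-reflexive (ΔS+cardLinesIn-compl S i≢i' j))

cardLinesIn≡0 : ∀ {n} (T : VSet n) {i i' : Fin n} →
                (∀ j → T (i , j) ≡ false × T (i' , j) ≡ false) → cardLinesIn T i i' ≡ 0
cardLinesIn≡0 {n} T {i} {i'} T≡false =
  trans (length-filter≡sum-χ (λ z → onLines i i' z ∧ T z) (vertices n)) (sum-map-zero vanish (vertices n))
  where
  vanish : ∀ z → χ (onLines i i' z ∧ T z) ≡ 0
  vanish (a , b) with a ≟F i | a ≟F i'
  ... | yes refl | _        = cong χ (proj₁ (T≡false b))
  ... | no _     | yes refl = cong χ (proj₂ (T≡false b))
  ... | no _     | no _     = refl

m∸n+p≤m+q⇒p≤n+q : ∀ {m n p q} → n ≤ m → m ∸ n + p ≤ m + q → p ≤ n + q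
m∸n+p≤m+q⇒p≤n+q {m} {n} {p} {q} n≤m m∸n+p≤m+q = +-cancelˡ-≤ (m ∸ n) p (n + q) (begin
  m ∸ n + p       ≤⟨ m∸n+p≤m+q ⟩
  m + q           ≡⟨ cong (_+ q) (sym (m∸n+n≡m n≤m)) ⟩
  m ∸ n + n + q   ≡⟨ +-assoc (m ∸ n) n q ⟩
  m ∸ n + (n + q) ∎)
  where open ≤-Reasoning

mainTheorem7 : (n t : ℕ) → 4 ≤ n → 1 ≤ t → t ≤ n ∸ 1 →
    (S : VSet n) → WeakResolving (2 * n ∸ 2 * t) S →
    (i i' : Fin n) → i ≢ i' →
    ((∃[ j ] (compl S (i , j) ≡ true × compl S (i' , j) ≡ true)) →
        cardLinesIn (compl S) i i' ≤ 2 * t)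
    × ((¬ (∃[ j ] (compl S (i , j) ≡ true × compl S (i' , j) ≡ true))) →
        cardLinesIn (compl S) i i' ≤ 2 * t + 1)
mainTheorem7 n@(suc (suc (suc _))) t (s≤s (s≤s (s≤s _))) _ t≤n-1 S resolving i i' i≢i' =
  both-in-complement , λ _ → some-in-complement
  where
  bound : ∀ j → cardLinesIn (compl S) i i' ≤ 2 * t + (χ (S (i , j)) + χ (S (i' , j)))
  bound j = m∸n+p≤m+q⇒p≤n+q (*-monoʳ-≤ 2 (≤-trans t≤n-1 (m∸n≤m n 1)))
                              (weakResolving⇒cardLinesIn-compl resolving i≢i' j)

  both-in-complement : ∃[ j ] (compl S (i , j) ≡ true × compl S (i' , j) ≡ true) →
                       cardLinesIn (compl S) i i' ≤ 2 * t
  both-in-complement (j , x∉S , y∉S) = ≤-trans (bound j)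
    (≤-reflexive (trans (cong₂ (λ u v → 2 * t + (u + v)) (χ≡0 x∉S) (χ≡0 y∉S)) (+-identityʳ (2 * t))))

  -- This bound does not need the hypothesis that no column lies in S̄ on both lines.
  some-in-complement : cardLinesIn (compl S) i i' ≤ 2 * t + 1
  some-in-complement with any? (λ j → (compl S (i , j) ≟B true) ⊎-dec (compl S (i' , j) ≟B true))
  ... | yes (j , x∉S⊎y∉S) = ≤-trans (bound j) (+-monoʳ-≤ (2 * t) (χ+χ≤1 x∉S⊎y∉S))
  ... | no lines⊆S        = subst (_≤ 2 * t + 1) (sym (cardLinesIn≡0 (compl S) in-S)) z≤n
    where
    in-S : ∀ j → compl S (i , j) ≡ false × compl S (i' , j) ≡ false
    in-S j = ¬-not (λ x∉S → lines⊆S (j , inj₁ x∉S)) , ¬-not (λ y∉S → lines⊆S (j , inj₂ y∉S))
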